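{- Let $t\ge3$ and $q\ge t$. In $\mathrm{PG}(2t-1,q)=\mathrm{PG}_q(\mathbb{F}_{q^t}^2)$ let $P=\langle(1,1)\rangle_q$ and, for $y\in\mathbb{F}_{q^t}\setminus\mathbb{F}_q$ and $h\in\{0,1,\ldots,t-1\}$, let $Q_{y,h}=\langle(y,y^{q^h})\rangle_q$. Then: (i) the points $P$ and $Q_{y,h}$ are distinct; (ii) for any point $Q\in\mathcal{Q}_{t-1,q}\setminus\{P\}$, the line $\langle P,Q\rangle$ is contained in $\mathcal{Q}_{t-1,q}$ if and only if there are $y\in\mathbb{F}_{q^t}\setminus\mathbb{F}_q$ and $h\in\{0,\ldots,t-1\}$ with $Q=Q_{y,h}$; (iii) for $y,y'\in\mathbb{F}_{q^t}\setminus\mathbb{F}_q$ and $h,h'\in\{0,\ldots,t-1\}$, $Q_{y,h}=Q_{y',h'}$ if and only if $\langle y\rangle_q=\langle y'\rangle_q$ and $[\mathbb{F}_q(y):\mathbb{F}_q]$ divides $h-h'$.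
   Context: $N(x)=x^{(q^t-1)/(q-1)}$ is the norm from $\mathbb{F}_{q^t}$ to $\mathbb{F}_q$. $\mathcal{Q}_{t-1,q}=\{\langle(a,b)\rangle_q: (a,b)\in\mathbb{F}_{q^t}^2\setminus\{(0,0)\},\ N(a)=N(b)\}$, a hypersurface of degree $t$ in $\mathrm{PG}(2t-1,q)$. $\langle y\rangle_q$ denotes the $\mathbb{F}_q$-span of $y$. -}

module Defs where

open import Level using (Level; _⊔_)
open import Algebra.Bundles using (CommutativeRing; Semiring)
open import Data.Nat as ℕ using (ℕ; zero; suc; _≤_; _<_; _∸_)
open import Data.Nat.Primality using (Prime)
open import Data.Fin using (Fin)
open import Data.Product using (Σ; _×_; _,_; ∃)
open import Data.Sum using (_⊎_)
open import Relation.Nullary using (¬_)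
open import Function.Bundles using (Inverse)
import Relation.Binary.PropositionalEquality as ≡

PrimePower : ℕ → Set
PrimePower q = Σ ℕ λ p → Σ ℕ λ e → Prime p × 1 ≤ e × q ≡.≡ p ℕ.^ e

record IsField {c ℓ : Level} (R : CommutativeRing c ℓ) : Set (c ⊔ ℓ) where
  open CommutativeRing R
  field
    nontrivial : ¬ (0# ≈ 1#)
    inverse    : ∀ x → ¬ (x ≈ 0#) → Σ Carrier λ y → x * y ≈ 1#

HasCard : {c ℓ : Level} → CommutativeRing c ℓ → ℕ → Set (c ⊔ ℓ)
HasCard R n = Inverse (CommutativeRing.setoid R) (≡.setoid (Fin n))

-- Definitions for F_{q^t} (the carrier of R) over its subfield F_q.
module FF {c ℓ : Level} (R : CommutativeRing c ℓ) (q t : ℕ) where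
  open CommutativeRing R
  open import Algebra.Definitions.RawSemiring (Semiring.rawSemiring semiring) using (_^_)

  K : Set c
  K = Carrier

  InFq : K → Set ℓ
  InFq x = x ^ q ≈ x

  -- the field norm N : F_{q^t} → F_q, N(x) = x^((q^t - 1)/(q - 1))
  --   = x^(1 + q + q^2 + ... + q^(t-1))
  normExp : ℕ → ℕ
  normExp zero    = 0
  normExp (suc k) = q ℕ.^ k ℕ.+ normExp k

  N : K → K
  N x = x ^ normExp t

  V : Set c
  V = K × K

  NonZero : V → Set ℓ
  NonZero (a , b) = ¬ (a ≈ 0#) ⊎ ¬ (b ≈ 0#)

  -- ⟨(a,b)⟩_q = ⟨(a',b')⟩_q  (same point of PG(2t-1,q)):
  -- (a',b') = λ (a,b) for some nonzero λ ∈ F_q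
  SamePoint : V → V → Set (c ⊔ ℓ)
  SamePoint (a , b) (a' , b') =
    Σ K λ l → InFq l × ¬ (l ≈ 0#) × (a' ≈ l * a) × (b' ≈ l * b)

  SameSpan : K → K → Set (c ⊔ ℓ)
  SameSpan y y' = Σ K λ l → InFq l × ¬ (l ≈ 0#) × (y' ≈ l * y)

  -- the point ⟨v⟩_q lies on the hypersurface Q_{t-1,q}
  InQ : V → Set ℓ
  InQ (a , b) = NonZero (a , b) × N a ≈ N b

  Pv : V
  Pv = (1# , 1#)

  Qv : K → ℕ → V
  Qv y h = (y , y ^ (q ℕ.^ h))

  -- the line ⟨⟨u⟩_q, ⟨v⟩_q⟩ is contained in Q_{t-1,q}: every point
  -- ⟨λu + μv⟩_q with λ, μ ∈ F_q (giving a nonzero vector) lies in Q_{t-1,q}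
  LineInQ : V → V → Set (c ⊔ ℓ)
  LineInQ (u₁ , u₂) (v₁ , v₂) =
    ∀ l m → InFq l → InFq m →
      NonZero (l * u₁ + m * v₁ , l * u₂ + m * v₂) →
      InQ (l * u₁ + m * v₁ , l * u₂ + m * v₂)

  InSubfield : ℕ → K → Set ℓ
  InSubfield d y = y ^ (q ℕ.^ d) ≈ y

  -- [F_q(y) : F_q] = d : F_q(y) is the smallest subfield F_{q^d} containing y,
  -- i.e. d ≥ 1 is least with y ∈ F_{q^d}
  DegreeIs : K → ℕ → Set ℓ
  DegreeIs y d = 1 ≤ d × InSubfield d y × (∀ e → 1 ≤ e → e < d → ¬ InSubfield e y)

  -- d divides h - h' (as integers), i.e. d ∣ |h - h'|
  DividesDiff : ℕ → ℕ → ℕ → Set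
  DividesDiff d h h' = (d ∣ (h ∸ h')) × (d ∣ (h' ∸ h))
    where open import Data.Nat.Divisibility using (_∣_)

module Submission where

-- For l ∈ F_q, N(l + x) = ∏_{i<t} (l + x^(q^i)); hence if
--    N(l + a) = N(l + b) on F_q then b = a^(q^i) for some i < t.
-- Then (i) is immediate, (ii, ⇐) follows from N ∘ φ_h = N, (ii, ⇒) from the last
-- point, and (iii) reduces y^(q^h) = y^(q^h') to the degree of y dividing h - h'.

open import Defs
open import Level using (Level; _⊔_)
open import Algebra.Bundles using (CommutativeRing; CommutativeMonoid)
open import Data.Nat as ℕ using (ℕ; zero; suc; _≤_; _<_; z≤n; s≤s)
import Data.Nat.Properties as ℕP
open import Data.Nat.Combinatorics using (_C_; nCn≡1; nC1≡n; k>n⇒nCk≡0; nCk+nC[k+1]≡[n+1]C[k+1])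
open import Data.Nat.Divisibility using (_∣_; divides; ∣⇒≤; _∣0; m%n≡0⇒n∣m)
open import Data.Nat.DivMod using (_%_; _/_; m≡m%n+[m/n]*n; m%n<n)
open import Data.Nat.Primality using (Prime; euclidsLemma; prime⇒nonZero; prime⇒nonTrivial)
open import Data.Product using (Σ; _×_; _,_; proj₁; proj₂)
open import Data.Sum using (_⊎_; inj₁; inj₂; [_,_])
open import Data.Empty using (⊥-elim)
open import Data.List using (List; []; _∷_; length; replicate; _++_; map; filter; tabulate)
open import Relation.Unary.Properties using (∁?)
open import Data.List.Relation.Unary.All using (All; []; _∷_)
open import Data.List.Relation.Unary.AllPairs using (AllPairs; []; _∷_)
open import Relation.Nullary using (¬_; Dec; yes; no)
open import Relation.Binary.Definitions using (Decidable)
open import Function.Bundles using (Inverse; _⇔_; mk⇔)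
open import Data.Fin as Fin using (Fin)
import Data.Fin.Properties as FinP
import Data.List.Properties as ListP
import Relation.Binary.PropositionalEquality as ≡
open import Data.Maybe using (nothing)
open import Tactic.RingSolver.Core.AlmostCommutativeRing using (AlmostCommutativeRing; fromCommutativeRing)

module BinomialCoefficients where
  open ≡ using (_≡_; cong; cong₂; trans)
  open ≡.≡-Reasoning
  open import Data.Nat using (_+_; _*_)
  open import Data.Nat.Tactic.RingSolver using (solve-∀)

  private
    regroupˡ : ∀ k A B → suc (suc k) * (A + B) ≡ (suc k * A + A) + suc (suc k) * B
    regroupˡ = solve-∀
    regroupʳ : ∀ n x A y → (suc n * x + A) + suc n * y ≡ suc n * (x + y) + A
    regroupʳ = solve-∀

  absorption : ∀ n k → suc k * (suc n C suc k) ≡ suc n * (n C k)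
  absorption zero zero = ≡.refl
  absorption zero (suc k) = begin
    suc (suc k) * (1 C suc (suc k)) ≡⟨ cong (suc (suc k) *_) (k>n⇒nCk≡0 {1} {suc (suc k)} (s≤s (s≤s z≤n))) ⟩
    suc (suc k) * 0                 ≡⟨ ℕP.*-zeroʳ (suc (suc k)) ⟩
    0                               ≡⟨ cong (1 *_) (k>n⇒nCk≡0 {0} {suc k} (s≤s z≤n)) ⟨
    1 * (0 C suc k)                 ∎
  absorption (suc n) zero = begin
    1 * (suc (suc n) C 1) ≡⟨ ℕP.*-identityˡ _ ⟩
    suc (suc n) C 1       ≡⟨ nC1≡n (suc (suc n)) ⟩
    suc (suc n)           ≡⟨ ℕP.*-identityʳ (suc (suc n)) ⟨
    suc (suc n) * 1       ∎
  absorption (suc n) (suc k) = begin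
    suc (suc k) * (suc (suc n) C suc (suc k)) ≡⟨ cong (suc (suc k) *_) (nCk+nC[k+1]≡[n+1]C[k+1] (suc n) (suc k)) ⟨
    suc (suc k) * (A + B)                     ≡⟨ regroupˡ k A B ⟩
    (suc k * A + A) + suc (suc k) * B         ≡⟨ cong₂ (λ u v → (u + A) + v) (absorption n k) (absorption n (suc k)) ⟩
    (suc n * (n C k) + A) + suc n * (n C suc k) ≡⟨ regroupʳ n (n C k) A (n C suc k) ⟩
    suc n * (n C k + n C suc k) + A           ≡⟨ cong (λ z → suc n * z + A) (nCk+nC[k+1]≡[n+1]C[k+1] n k) ⟩
    suc n * A + A                             ≡⟨ ℕP.+-comm (suc n * A) A ⟩
    suc (suc n) * A                           ∎
    where
    A = suc n C suc k
    B = suc n C suc (suc k)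

  -- p ∣ k·C(p,k) = p·C(p-1,k-1) and p ∤ k, so p ∣ C(p,k) by Euclid's lemma
  prime∣binomial : ∀ {p} → Prime p → ∀ k → 1 ≤ k → k < p → p ∣ (p C k)
  prime∣binomial {suc n} p-prime (suc k) _ k<p
    with euclidsLemma (suc k) (suc n C suc k) p-prime
           (divides (n C k) (trans (absorption n k) (ℕP.*-comm (suc n) (n C k))))
  ... | inj₂ p∣C = p∣C
  ... | inj₁ p∣k = ⊥-elim (ℕP.<⇒≱ k<p (∣⇒≤ p∣k))

module RingIdentities {c ℓ} (R : CommutativeRing c ℓ) where
  open import Tactic.RingSolver using (solve-∀)
  ring : AlmostCommutativeRing c ℓ
  ring = fromCommutativeRing R (λ _ → nothing)
  open AlmostCommutativeRing ring

  eval-⊕-step : ∀ a b z f g → (a + b) + z * (f + g) ≈ (a + z * f) + (b + z * g)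
  eval-⊕-step = solve-∀ ring
  eval-scale-step : ∀ c a z f → c * a + z * (c * f) ≈ c * (a + z * f)
  eval-scale-step = solve-∀ ring
  division-step : ∀ a d r f c → a + (d + r) * (d * f + c) ≈ d * (c + (d + r) * f) + (a + r * c)
  division-step = solve-∀ ring
  linear-factor-step : ∀ z zD f c → z * zD + (z * f + (c * f + zD * c)) ≈ (z + c) * (zD + f)
  linear-factor-step = solve-∀ ring
  geometric-step : ∀ w wj g → w * wj + (1# + w * g) ≈ 1# + w * (wj + g)
  geometric-step = solve-∀ ring
  scalar-mix : ∀ l x m a → l * (x + m * a) ≈ l * x + m * (l * a)
  scalar-mix = solve-∀ ring

module FieldLemmas {c ℓ} (R : CommutativeRing c ℓ) (isField : IsField R) where
  open CommutativeRing R
  open IsField isField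
  open import Relation.Binary.Reasoning.Setoid setoid
  open import Algebra.Properties.Semiring.Exp semiring using (_^_)

  1≉0 : 1# ≉ 0#
  1≉0 1≈0 = nontrivial (sym 1≈0)

  *-cancelˡ : ∀ {z x y} → z ≉ 0# → z * x ≈ z * y → x ≈ y
  *-cancelˡ {z} {x} {y} z≉0 zx≈zy = begin
    x            ≈⟨ *-identityˡ x ⟨
    1# * x       ≈⟨ *-congʳ wz≈1 ⟨
    (w * z) * x  ≈⟨ *-assoc w z x ⟩
    w * (z * x)  ≈⟨ *-congˡ zx≈zy ⟩
    w * (z * y)  ≈⟨ *-assoc w z y ⟨
    (w * z) * y  ≈⟨ *-congʳ wz≈1 ⟩
    1# * y       ≈⟨ *-identityˡ y ⟩
    y            ∎
    where
    w = proj₁ (inverse z z≉0)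
    wz≈1 : w * z ≈ 1#
    wz≈1 = trans (*-comm w z) (proj₂ (inverse z z≉0))

  *-cancelʳ : ∀ {z x y} → z ≉ 0# → x * z ≈ y * z → x ≈ y
  *-cancelʳ {z} {x} {y} z≉0 xz≈yz = *-cancelˡ z≉0 (trans (*-comm z x) (trans xz≈yz (*-comm y z)))

  0^k≈0 : ∀ k → 1 ≤ k → 0# ^ k ≈ 0#
  0^k≈0 (suc k) _ = zeroˡ _

  1^k≈1 : ∀ k → 1# ^ k ≈ 1#
  1^k≈1 zero = refl
  1^k≈1 (suc k) = trans (*-identityˡ _) (1^k≈1 k)

module DecidableFieldLemmas {c ℓ} (R : CommutativeRing c ℓ) (isField : IsField R)
  (_≟_ : Decidable (CommutativeRing._≈_ R)) where
  open CommutativeRing R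
  open FieldLemmas R isField
  open import Algebra.Properties.Semiring.Exp semiring using (_^_)

  zero-product : ∀ {x y} → x * y ≈ 0# → x ≈ 0# ⊎ y ≈ 0#
  zero-product {x} {y} xy≈0 with x ≟ 0#
  ... | yes x≈0 = inj₁ x≈0
  ... | no x≉0 = inj₂ (*-cancelˡ x≉0 (trans xy≈0 (sym (zeroʳ x))))

  *-nonzero : ∀ {x y} → x ≉ 0# → y ≉ 0# → x * y ≉ 0#
  *-nonzero x≉0 y≉0 xy≈0 with zero-product xy≈0
  ... | inj₁ x≈0 = x≉0 x≈0
  ... | inj₂ y≈0 = y≉0 y≈0

  x^k≈0⇒x≈0 : ∀ {x} k → x ^ k ≈ 0# → x ≈ 0#
  x^k≈0⇒x≈0 zero 1≈0 = ⊥-elim (1≉0 1≈0)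
  x^k≈0⇒x≈0 (suc k) xxᵏ≈0 with zero-product xxᵏ≈0
  ... | inj₁ x≈0 = x≈0
  ... | inj₂ xᵏ≈0 = x^k≈0⇒x≈0 k xᵏ≈0

-- Polynomials over a field with decidable equality, represented by their lists of
-- coefficients (constant term first) and studied through evaluation.
module Polynomials {c ℓ} (R : CommutativeRing c ℓ) (isField : IsField R)
  (_≟_ : Decidable (CommutativeRing._≈_ R)) where
  open CommutativeRing R
  open FieldLemmas R isField
  open DecidableFieldLemmas R isField _≟_
  open RingIdentities R using (eval-⊕-step; eval-scale-step; division-step; linear-factor-step; geometric-step)
  open import Relation.Binary.Reasoning.Setoid setoid
  open import Algebra.Properties.Semiring.Exp semiring using (_^_; ^-congʳ; ^-homo-*)
  open import Algebra.Properties.Ring ring using (-1*x≈-x)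
  open import Algebra.Properties.Group +-group using (x∙y⁻¹≈ε⇒x≈y)
  import Data.List.Relation.Unary.All as All

  Poly : Set c
  Poly = List Carrier

  eval : Poly → Carrier → Carrier
  eval [] z = 0#
  eval (a ∷ f) z = a + z * eval f z

  eval-constant : ∀ a z → eval (a ∷ []) z ≈ a
  eval-constant a z = trans (+-congˡ (zeroʳ z)) (+-identityʳ a)

  _⊕_ : Poly → Poly → Poly
  [] ⊕ g = g
  (a ∷ f) ⊕ [] = a ∷ f
  (a ∷ f) ⊕ (b ∷ g) = (a + b) ∷ (f ⊕ g)

  eval-⊕ : ∀ f g z → eval (f ⊕ g) z ≈ eval f z + eval g z
  eval-⊕ [] g z = sym (+-identityˡ _)
  eval-⊕ (a ∷ f) [] z = sym (+-identityʳ _)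
  eval-⊕ (a ∷ f) (b ∷ g) z = trans (+-congˡ (*-congˡ (eval-⊕ f g z))) (eval-⊕-step a b z (eval f z) (eval g z))

  length-⊕ : ∀ {n} f g → length f ≤ n → length g ≤ n → length (f ⊕ g) ≤ n
  length-⊕ [] g _ g≤n = g≤n
  length-⊕ (a ∷ f) [] f≤n _ = f≤n
  length-⊕ (a ∷ f) (b ∷ g) (s≤s f≤n) (s≤s g≤n) = s≤s (length-⊕ f g f≤n g≤n)

  scale : Carrier → Poly → Poly
  scale c = map (c *_)

  eval-scale : ∀ c f z → eval (scale c f) z ≈ c * eval f z
  eval-scale c [] z = sym (zeroʳ c)
  eval-scale c (a ∷ f) z = trans (+-congˡ (*-congˡ (eval-scale c f z))) (eval-scale-step c a z (eval f z))

  shift : ℕ → Poly → Poly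
  shift D f = replicate D 0# ++ f

  eval-shift : ∀ D f z → eval (shift D f) z ≈ z ^ D * eval f z
  eval-shift zero f z = sym (*-identityˡ _)
  eval-shift (suc D) f z = begin
    0# + z * eval (shift D f) z ≈⟨ +-identityˡ _ ⟩
    z * eval (shift D f) z      ≈⟨ *-congˡ (eval-shift D f z) ⟩
    z * (z ^ D * eval f z)      ≈⟨ *-assoc z (z ^ D) (eval f z) ⟨
    z ^ suc D * eval f z        ∎

  length-shift : ∀ D f → length (shift D f) ≡.≡ D ℕ.+ length f
  length-shift D f = ≡.trans (ListP.length-++ (replicate D 0#)) (≡.cong (ℕ._+ length f) (ListP.length-replicate D))

  quotient : Carrier → Poly → Poly
  quotient r [] = []
  quotient r (a ∷ []) = []
  quotient r (a ∷ b ∷ f) = eval (b ∷ f) r ∷ quotient r (b ∷ f)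

  division : ∀ r f z → eval f z ≈ (z - r) * eval (quotient r f) z + eval f r
  division r [] z = sym (trans (+-identityʳ _) (zeroʳ _))
  division r (a ∷ []) z = begin
    eval (a ∷ []) z                    ≈⟨ eval-constant a z ⟩
    a                                  ≈⟨ eval-constant a r ⟨
    eval (a ∷ []) r                    ≈⟨ +-identityˡ _ ⟨
    0# + eval (a ∷ []) r               ≈⟨ +-congʳ (zeroʳ _) ⟨
    (z - r) * 0# + eval (a ∷ []) r     ∎
  division r (a ∷ b ∷ f) z = begin
    a + z * eval (b ∷ f) z                        ≈⟨ +-congˡ (*-cong z≈[z-r]+r (division r (b ∷ f) z)) ⟩
    a + ((z - r) + r) * ((z - r) * Q + C)        ≈⟨ division-step a (z - r) r Q C ⟩
    (z - r) * (C + ((z - r) + r) * Q) + (a + r * C) ≈⟨ +-congʳ (*-congˡ (+-congˡ (*-congʳ (sym z≈[z-r]+r)))) ⟩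
    (z - r) * (C + z * Q) + (a + r * C)          ∎
    where
    Q = eval (quotient r (b ∷ f)) z
    C = eval (b ∷ f) r
    z≈[z-r]+r : z ≈ (z - r) + r
    z≈[z-r]+r = sym (trans (+-assoc z (- r) r) (trans (+-congˡ (-‿inverseˡ r)) (+-identityʳ z)))

  length-quotient : ∀ {n} r f → length f ≤ suc n → length (quotient r f) ≤ n
  length-quotient r [] _ = z≤n
  length-quotient r (a ∷ []) _ = z≤n
  length-quotient {suc n} r (a ∷ b ∷ f) (s≤s f≤n) = s≤s (length-quotient r (b ∷ f) f≤n)

  IsZero : Poly → Set (c ⊔ ℓ)
  IsZero f = All (_≈ 0#) f

  eval-IsZero : ∀ {f} z → IsZero f → eval f z ≈ 0#
  eval-IsZero z [] = refl
  eval-IsZero z (a≈0 ∷ f≈0) = trans (+-cong a≈0 (trans (*-congˡ (eval-IsZero z f≈0)) (zeroʳ z))) (+-identityʳ 0#)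

  quotient-IsZero : ∀ r f → IsZero (quotient r f) → eval f r ≈ 0# → IsZero f
  quotient-IsZero r [] _ _ = []
  quotient-IsZero r (a ∷ []) _ fr≈0 = trans (sym (eval-constant a r)) fr≈0 ∷ []
  quotient-IsZero r (a ∷ b ∷ f) (c≈0 ∷ q≈0) fr≈0 = a≈0 ∷ quotient-IsZero r (b ∷ f) q≈0 c≈0
    where
    a≈0 : a ≈ 0#
    a≈0 = begin
      a                      ≈⟨ +-identityʳ a ⟨
      a + 0#                 ≈⟨ +-congˡ (trans (*-congˡ c≈0) (zeroʳ r)) ⟨
      a + r * eval (b ∷ f) r ≈⟨ fr≈0 ⟩
      0#                     ∎

  Roots : Poly → List Carrier → Set (c ⊔ ℓ)
  Roots f rs = All (λ r → eval f r ≈ 0#) rs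

  quotient-Roots : ∀ r f rs → eval f r ≈ 0# → All (_≉ r) rs → Roots f rs → Roots (quotient r f) rs
  quotient-Roots r f [] _ _ _ = []
  quotient-Roots r f (r′ ∷ rs) fr≈0 (r′≉r ∷ rs≉r) (fr′≈0 ∷ frs≈0) = qr′≈0 ∷ quotient-Roots r f rs fr≈0 rs≉r frs≈0
    where
    r′-r≉0 : r′ - r ≉ 0#
    r′-r≉0 d≈0 = r′≉r (x∙y⁻¹≈ε⇒x≈y r′ r d≈0)
    qr′≈0 : eval (quotient r f) r′ ≈ 0#
    qr′≈0 = *-cancelˡ r′-r≉0 (begin
      (r′ - r) * eval (quotient r f) r′          ≈⟨ +-identityʳ _ ⟨
      (r′ - r) * eval (quotient r f) r′ + 0#     ≈⟨ +-congˡ fr≈0 ⟨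
      (r′ - r) * eval (quotient r f) r′ + eval f r ≈⟨ division r f r′ ⟨
      eval f r′                                  ≈⟨ fr′≈0 ⟩
      0#                                         ≈⟨ zeroʳ _ ⟨
      (r′ - r) * 0#                              ∎)

  vanishing : ∀ rs f → length f ≤ length rs → AllPairs _≉_ rs → Roots f rs → IsZero f
  vanishing [] [] _ _ _ = []
  vanishing (r ∷ rs) f f≤ (r≉rs ∷ distinct) (fr≈0 ∷ frs≈0) =
    quotient-IsZero r f (vanishing rs (quotient r f) (length-quotient r f f≤) distinct
      (quotient-Roots r f rs fr≈0 (All.map (λ r≉r′ r′≈r → r≉r′ (sym r′≈r)) r≉rs) frs≈0)) fr≈0

  agreement : ∀ rs f g → length f ≤ length rs → length g ≤ length rs → AllPairs _≉_ rs →
              All (λ r → eval f r ≈ eval g r) rs → ∀ z → eval f z ≈ eval g z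
  agreement rs f g f≤ g≤ distinct agree z =
    x∙y⁻¹≈ε⇒x≈y _ _ (trans (sym (eval-difference z)) (eval-IsZero z (vanishing rs d d≤ distinct (roots rs agree))))
    where
    d = f ⊕ scale (- 1#) g
    eval-difference : ∀ z → eval d z ≈ eval f z - eval g z
    eval-difference z = trans (eval-⊕ f _ z) (+-congˡ (trans (eval-scale (- 1#) g z) (-1*x≈-x _)))
    d≤ : length d ≤ length rs
    d≤ = length-⊕ f _ f≤ (ℕP.≤-trans (ℕP.≤-reflexive (ListP.length-map (- 1# *_) g)) g≤)
    roots : ∀ rs → All (λ r → eval f r ≈ eval g r) rs → Roots d rs
    roots [] [] = []
    roots (r ∷ rs) (fr≈gr ∷ agree) = trans (eval-difference r) (trans (+-congʳ fr≈gr) (-‿inverseʳ _)) ∷ roots rs agree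

  monic : ℕ → Poly → Poly
  monic D f = f ⊕ shift D (1# ∷ [])

  eval-monic : ∀ D f z → eval (monic D f) z ≈ z ^ D + eval f z
  eval-monic D f z = begin
    eval (monic D f) z                      ≈⟨ eval-⊕ f _ z ⟩
    eval f z + eval (shift D (1# ∷ [])) z   ≈⟨ +-congˡ (eval-shift D (1# ∷ []) z) ⟩
    eval f z + z ^ D * eval (1# ∷ []) z     ≈⟨ +-congˡ (trans (*-congˡ (eval-constant 1# z)) (*-identityʳ _)) ⟩
    eval f z + z ^ D                        ≈⟨ +-comm _ _ ⟩
    z ^ D + eval f z                        ∎

  length-monic : ∀ D f → length f ≤ D → length (monic D f) ≤ suc D
  length-monic D f f≤D = length-⊕ f _ (ℕP.m≤n⇒m≤1+n f≤D)
    (ℕP.≤-reflexive (≡.trans (length-shift D (1# ∷ [])) (ℕP.+-comm D 1)))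

  monic-nonzero : ∀ D f → length f ≤ D → ¬ IsZero (monic D f)
  monic-nonzero zero [] _ (1≈0 ∷ []) = 1≉0 1≈0
  monic-nonzero (suc D) [] _ (_ ∷ rest) = monic-nonzero D [] z≤n rest
  monic-nonzero (suc D) (a ∷ f) (s≤s f≤D) (_ ∷ rest) = monic-nonzero D f f≤D rest

  root-bound : ∀ D f rs → length f ≤ D → AllPairs _≉_ rs →
               All (λ r → r ^ D + eval f r ≈ 0#) rs → length rs ≤ D
  root-bound D f rs f≤D distinct roots with length rs ℕ.≤? D
  ... | yes rs≤D = rs≤D
  ... | no rs≰D = ⊥-elim (monic-nonzero D f f≤D
        (vanishing rs (monic D f) (ℕP.≤-trans (length-monic D f f≤D) (ℕP.≰⇒> rs≰D)) distinct
          (All.map (λ {r} r≈0 → trans (eval-monic D f r) r≈0) roots)))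

  linearProduct : ℕ → (ℕ → Carrier) → Carrier → Carrier
  linearProduct zero cs z = 1#
  linearProduct (suc k) cs z = (z + cs k) * linearProduct k cs z

  linearProduct-root : ∀ k cs z → linearProduct k cs z ≈ 0# → Σ ℕ λ i → i < k × z + cs i ≈ 0#
  linearProduct-root zero cs z 1≈0 = ⊥-elim (1≉0 1≈0)
  linearProduct-root (suc k) cs z ≈0 with zero-product ≈0
  ... | inj₁ factor≈0 = k , ℕP.n<1+n k , factor≈0
  ... | inj₂ rest≈0 with linearProduct-root k cs z rest≈0
  ... | i , i<k , factor≈0 = i , ℕP.m<n⇒m<1+n i<k , factor≈0

  linearProduct-factor : ∀ k cs z → z + cs 0 ≈ 0# → 1 ≤ k → linearProduct k cs z ≈ 0#
  linearProduct-factor (suc zero) cs z factor≈0 _ = trans (*-congʳ factor≈0) (zeroˡ _)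
  linearProduct-factor (suc (suc k)) cs z factor≈0 _ =
    trans (*-congˡ (linearProduct-factor (suc k) cs z factor≈0 (s≤s z≤n))) (zeroʳ _)

  timesLinear : ℕ → Carrier → Poly → Poly
  timesLinear D c f = (0# ∷ f) ⊕ (scale c f ⊕ shift D (c ∷ []))

  eval-timesLinear : ∀ D c f z → z ^ suc D + eval (timesLinear D c f) z ≈ (z + c) * (z ^ D + eval f z)
  eval-timesLinear D c f z = begin
    z * z ^ D + eval (timesLinear D c f) z                   ≈⟨ +-congˡ (eval-⊕ (0# ∷ f) rest z) ⟩
    z * z ^ D + (eval (0# ∷ f) z + eval rest z)              ≈⟨ +-congˡ (+-cong (+-identityˡ _) eval-rest) ⟩
    z * z ^ D + (z * eval f z + (c * eval f z + z ^ D * c))  ≈⟨ linear-factor-step z (z ^ D) (eval f z) c ⟩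
    (z + c) * (z ^ D + eval f z)                             ∎
    where
    rest = scale c f ⊕ shift D (c ∷ [])
    eval-rest : eval rest z ≈ c * eval f z + z ^ D * c
    eval-rest = trans (eval-⊕ (scale c f) (shift D (c ∷ [])) z)
                  (+-cong (eval-scale c f z) (trans (eval-shift D (c ∷ []) z) (*-congˡ (eval-constant c z))))

  length-timesLinear : ∀ D c f → length f ≤ D → length (timesLinear D c f) ≤ suc D
  length-timesLinear D c f f≤D = length-⊕ (0# ∷ f) (scale c f ⊕ shift D (c ∷ [])) (s≤s f≤D)
    (length-⊕ (scale c f) (shift D (c ∷ [])) (ℕP.≤-trans (ℕP.≤-reflexive (ListP.length-map (c *_) f)) (ℕP.m≤n⇒m≤1+n f≤D))
      (ℕP.≤-reflexive (≡.trans (length-shift D (c ∷ [])) (ℕP.+-comm D 1))))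

  lowerPart : ℕ → (ℕ → Carrier) → Poly
  lowerPart zero cs = []
  lowerPart (suc k) cs = timesLinear k (cs k) (lowerPart k cs)

  eval-lowerPart : ∀ k cs z → z ^ k + eval (lowerPart k cs) z ≈ linearProduct k cs z
  eval-lowerPart zero cs z = +-identityʳ 1#
  eval-lowerPart (suc k) cs z =
    trans (eval-timesLinear k (cs k) (lowerPart k cs) z) (*-congˡ (eval-lowerPart k cs z))

  length-lowerPart : ∀ k cs → length (lowerPart k cs) ≤ k
  length-lowerPart zero cs = z≤n
  length-lowerPart (suc k) cs = length-timesLinear k (cs k) (lowerPart k cs) (length-lowerPart k cs)

  geometric : ℕ → Carrier → Carrier
  geometric zero w = 1#
  geometric (suc j) w = 1# + w * geometric j w

  geometric-top : ∀ j w → w ^ suc j + geometric j w ≈ geometric (suc j) w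
  geometric-top zero w = +-comm _ _
  geometric-top (suc j) w = begin
    w * w ^ suc j + (1# + w * geometric j w) ≈⟨ geometric-step w (w ^ suc j) (geometric j w) ⟩
    1# + w * (w ^ suc j + geometric j w)     ≈⟨ +-congˡ (*-congˡ (geometric-top j w)) ⟩
    1# + w * geometric (suc j) w             ∎

  geometric-root : ∀ j w → w ^ suc j ≈ 1# → w ≉ 1# → geometric j w ≈ 0#
  geometric-root j w w^[j+1]≈1 w≉1 with geometric j w ≟ 0#
  ... | yes G≈0 = G≈0
  ... | no G≉0 = ⊥-elim (w≉1 (sym (*-cancelʳ G≉0 (trans (*-identityˡ _) G≈wG))))
    where
    open import Algebra.Properties.Group +-group using (∙-cancelˡ)
    G≈wG : geometric j w ≈ w * geometric j w
    G≈wG = ∙-cancelˡ 1# _ _ (trans (+-congʳ (sym w^[j+1]≈1)) (geometric-top j w))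

  geometricLowerPart : ℕ → ℕ → Poly
  geometricLowerPart s zero = []
  geometricLowerPart s (suc j) = (1# ∷ []) ⊕ shift s (geometricLowerPart s j)

  eval-geometricLowerPart : ∀ s j z → z ^ (s ℕ.* j) + eval (geometricLowerPart s j) z ≈ geometric j (z ^ s)
  eval-geometricLowerPart s zero z = trans (+-identityʳ _) (^-congʳ z (ℕP.*-zeroʳ s))
  eval-geometricLowerPart s (suc j) z = begin
    z ^ (s ℕ.* suc j) + eval ((1# ∷ []) ⊕ shift s low) z
      ≈⟨ +-cong (^-congʳ z (ℕP.*-suc s j)) (eval-⊕ (1# ∷ []) (shift s low) z) ⟩
    z ^ (s ℕ.+ s ℕ.* j) + (eval (1# ∷ []) z + eval (shift s low) z)
      ≈⟨ +-cong (^-homo-* z s (s ℕ.* j)) (+-cong (eval-constant 1# z) (eval-shift s low z)) ⟩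
    z ^ s * z ^ (s ℕ.* j) + (1# + z ^ s * eval low z)
      ≈⟨ geometric-step (z ^ s) (z ^ (s ℕ.* j)) (eval low z) ⟩
    1# + z ^ s * (z ^ (s ℕ.* j) + eval low z)
      ≈⟨ +-congˡ (*-congˡ (eval-geometricLowerPart s j z)) ⟩
    1# + z ^ s * geometric j (z ^ s) ∎
    where low = geometricLowerPart s j

  length-geometricLowerPart : ∀ s j → 1 ≤ s → length (geometricLowerPart s j) ≤ s ℕ.* j
  length-geometricLowerPart s zero _ = z≤n
  length-geometricLowerPart s (suc j) 1≤s = length-⊕ (1# ∷ []) (shift s (geometricLowerPart s j))
    (ℕP.≤-trans 1≤s (ℕP.≤-trans (ℕP.m≤m+n s (s ℕ.* j)) s+sj≤))
    (ℕP.≤-trans (ℕP.≤-reflexive (length-shift s _)) (ℕP.≤-trans (ℕP.+-monoʳ-≤ s (length-geometricLowerPart s j 1≤s)) s+sj≤))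
    where
    s+sj≤ : s ℕ.+ s ℕ.* j ≤ s ℕ.* suc j
    s+sj≤ = ℕP.≤-reflexive (≡.sym (ℕP.*-suc s j))

-- Enumerating its elements through the bijection with
-- Fin n gives decidable equality and lets us sum (or multiply) over all elements;
-- reindexing such sums along x ↦ x + a and x ↦ a·x yields n·a = 0 and Fermat's
-- little theorem a^n = a.
module FiniteField {c ℓ} (R : CommutativeRing c ℓ) (isField : IsField R) {n : ℕ} (card : HasCard R n) where
  open CommutativeRing R
  open FieldLemmas R isField
  open import Relation.Binary.Reasoning.Setoid setoid
  open import Algebra.Properties.Semiring.Exp semiring using (_^_; ^-congˡ)
  open import Algebra.Properties.Semiring.Mult semiring using () renaming (_×_ to _·_)
  open Inverse card using (to; from; to-cong)

  from-to : ∀ x → from (to x) ≈ x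
  from-to x = Inverse.inverseʳ card ≡.refl

  to-from : ∀ i → to (from i) ≡.≡ i
  to-from i = Inverse.inverseˡ card refl

  from-injective : ∀ {i j} → from i ≈ from j → i ≡.≡ j
  from-injective {i} {j} eq = ≡.trans (≡.sym (to-from i)) (≡.trans (to-cong eq) (to-from j))

  infix 4 _≟_
  _≟_ : Decidable _≈_
  x ≟ y with to x Fin.≟ to y
  ... | yes tx≡ty = yes (trans (sym (from-to x)) (trans (Inverse.from-cong card tx≡ty) (from-to y)))
  ... | no tx≢ty = no (λ x≈y → tx≢ty (to-cong x≈y))

  open DecidableFieldLemmas R isField _≟_ using (*-nonzero)

  1≤n : 1 ≤ n
  1≤n = ℕP.≤-trans (s≤s z≤n) (FinP.toℕ<n (to 0#))

  module FieldSum {a b} (M : CommutativeMonoid a b) where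
    open CommutativeMonoid M using () renaming (Carrier to A; _≈_ to _≈ᴹ_; ε to εᴹ)
    open CommutativeMonoid M using (∙-congˡ; ∙-congʳ; identityˡ; identityʳ) renaming (trans to transᴹ)
    open import Algebra.Properties.CommutativeMonoid.Sum M public
      using (sum; sum-permute; sum-cong-≋; ∑-distrib-+; sum-replicate; sum-replicate-zero)
    open import Data.Fin.Permutation using (permutation)

    ∑ : (Carrier → A) → A
    ∑ h = sum (λ i → h (from i))

    ∑-reindex : (g g′ : Carrier → Carrier) → (∀ {x y} → x ≈ y → g x ≈ g y) → (∀ {x y} → x ≈ y → g′ x ≈ g′ y) →
                (∀ x → g (g′ x) ≈ x) → (∀ x → g′ (g x) ≈ x) →
                (h : Carrier → A) → (∀ {x y} → x ≈ y → h x ≈ᴹ h y) → ∑ h ≈ᴹ ∑ (λ x → h (g x))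
    ∑-reindex g g′ g-cong g′-cong gg′ g′g h h-cong =
      transᴹ (sum-permute (λ i → h (from i)) π) (sum-cong-≋ {n} (λ i → h-cong (from-to (g (from i)))))
      where
      π = permutation (λ i → to (g (from i))) (λ i → to (g′ (from i)))
            (λ j → ≡.trans (to-cong (g-cong (from-to _))) (≡.trans (to-cong (gg′ (from j))) (to-from j)))
            (λ j → ≡.trans (to-cong (g′-cong (from-to _))) (≡.trans (to-cong (g′g (from j))) (to-from j)))

    sum-single : ∀ {m} (j : Fin m) (f : Fin m → A) → (∀ i → ¬ (i ≡.≡ j) → f i ≈ᴹ εᴹ) → sum f ≈ᴹ f j
    sum-single {suc m} Fin.zero f f≈ε =
      transᴹ (∙-congˡ (transᴹ (sum-cong-≋ {m} (λ i → f≈ε (Fin.suc i) (λ ()))) (sum-replicate-zero m))) (identityʳ _)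
    sum-single {suc m} (Fin.suc j) f f≈ε = transᴹ (∙-congʳ (f≈ε Fin.zero (λ ()))) (transᴹ (identityˡ _)
      (sum-single j (λ i → f (Fin.suc i)) (λ i i≢j → f≈ε (Fin.suc i) (λ eq → i≢j (FinP.suc-injective eq)))))

  private
    module Additive = FieldSum +-commutativeMonoid
    module Multiplicative = FieldSum *-commutativeMonoid

  -- summing over x + a instead of x shows that n·a = 0
  n·x≈0 : ∀ a → n · a ≈ 0#
  n·x≈0 a = sym (∙-cancelʳ S 0# (n · a) (begin
    0# + S                              ≈⟨ +-identityˡ S ⟩
    S                                   ≈⟨ Additive.∑-reindex (a +_) (_- a) +-congˡ +-congʳ
                                             a+[x-a]≈x [a+x]-a≈x (λ x → x) (λ x≈y → x≈y) ⟩
    Additive.∑ (a +_)                   ≈⟨ Additive.∑-distrib-+ {n} (λ _ → a) from ⟩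
    Additive.sum {n} (λ _ → a) + S      ≈⟨ +-congʳ (Additive.sum-replicate n) ⟩
    n · a + S                           ∎))
    where
    open import Algebra.Properties.Group +-group using (∙-cancelʳ)
    S = Additive.∑ (λ x → x)
    [a+x]-a≈x : ∀ x → (a + x) - a ≈ x
    [a+x]-a≈x x = trans (+-congʳ (+-comm a x)) (trans (+-assoc x a (- a)) (trans (+-congˡ (-‿inverseʳ a)) (+-identityʳ x)))
    a+[x-a]≈x : ∀ x → a + (x - a) ≈ x
    a+[x-a]≈x x = trans (sym (+-assoc a x (- a))) ([a+x]-a≈x x)

  caseZero : Carrier → Carrier → Carrier → Carrier
  caseZero e a b with e ≟ 0#
  ... | yes _ = a
  ... | no _ = b

  caseZero-zero : ∀ {e} a b → e ≈ 0# → caseZero e a b ≈ a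
  caseZero-zero {e} a b e≈0 with e ≟ 0#
  ... | yes _ = refl
  ... | no e≉0 = ⊥-elim (e≉0 e≈0)

  caseZero-nonzero : ∀ {e} a b → e ≉ 0# → caseZero e a b ≈ b
  caseZero-nonzero {e} a b e≉0 with e ≟ 0#
  ... | yes e≈0 = ⊥-elim (e≉0 e≈0)
  ... | no _ = refl

  unitPart : Carrier → Carrier
  unitPart e = caseZero e 1# e

  unitPart-nonzero : ∀ e → unitPart e ≉ 0#
  unitPart-nonzero e with e ≟ 0#
  ... | yes _ = 1≉0
  ... | no e≉0 = e≉0

  unitPart-cong : ∀ {x y} → x ≈ y → unitPart x ≈ unitPart y
  unitPart-cong {x} {y} x≈y = by-cases (y ≟ 0#)
    where
    by-cases : Dec (y ≈ 0#) → unitPart x ≈ unitPart y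
    by-cases (yes y≈0) = trans (caseZero-zero 1# x (trans x≈y y≈0)) (sym (caseZero-zero 1# y y≈0))
    by-cases (no y≉0) = trans (caseZero-nonzero 1# x (λ x≈0 → y≉0 (trans (sym x≈y) x≈0)))
                              (trans x≈y (sym (caseZero-nonzero 1# y y≉0)))

  scaled-unitPart : ∀ {a} e → a ≉ 0# → a * unitPart e ≈ unitPart (a * e) * caseZero e a 1#
  scaled-unitPart {a} e a≉0 = by-cases (e ≟ 0#)
    where
    by-cases : Dec (e ≈ 0#) → a * unitPart e ≈ unitPart (a * e) * caseZero e a 1#
    by-cases (yes e≈0) = begin
      a * unitPart e                   ≈⟨ *-congˡ (caseZero-zero 1# e e≈0) ⟩
      a * 1#                           ≈⟨ *-comm a 1# ⟩
      1# * a                           ≈⟨ *-cong (caseZero-zero 1# (a * e) (trans (*-congˡ e≈0) (zeroʳ a))) (caseZero-zero a 1# e≈0) ⟨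
      unitPart (a * e) * caseZero e a 1# ∎
    by-cases (no e≉0) = begin
      a * unitPart e                   ≈⟨ *-congˡ (caseZero-nonzero 1# e e≉0) ⟩
      a * e                            ≈⟨ *-identityʳ _ ⟨
      (a * e) * 1#                     ≈⟨ *-cong (caseZero-nonzero 1# (a * e) (*-nonzero a≉0 e≉0)) (caseZero-nonzero a 1# e≉0) ⟨
      unitPart (a * e) * caseZero e a 1# ∎

  ∏-nonzero : ∀ {m} (f : Fin m → Carrier) → (∀ i → f i ≉ 0#) → Multiplicative.sum f ≉ 0#
  ∏-nonzero {zero} f _ = 1≉0
  ∏-nonzero {suc m} f f≉0 = *-nonzero (f≉0 Fin.zero) (∏-nonzero (λ i → f (Fin.suc i)) (λ i → f≉0 (Fin.suc i)))

  -- Fermat's little theorem: comparing ∏ unitPart(e) with ∏ unitPart(a·e) over all e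
  fermat : ∀ a → a ^ n ≈ a
  fermat a with a ≟ 0#
  ... | yes a≈0 = trans (^-congˡ n a≈0) (trans (0^k≈0 n 1≤n) (sym a≈0))
  ... | no a≉0 = *-cancelʳ (∏-nonzero (λ i → unitPart (from i)) (λ i → unitPart-nonzero (from i))) (begin
    a ^ n * P                                          ≈⟨ *-congʳ (Multiplicative.sum-replicate n) ⟨
    Multiplicative.sum {n} (λ _ → a) * P               ≈⟨ Multiplicative.∑-distrib-+ {n} (λ _ → a) (λ i → unitPart (from i)) ⟨
    Multiplicative.∑ (λ e → a * unitPart e)            ≈⟨ Multiplicative.sum-cong-≋ {n} (λ i → scaled-unitPart (from i) a≉0) ⟩
    Multiplicative.∑ (λ e → unitPart (a * e) * caseZero e a 1#)
                                                       ≈⟨ Multiplicative.∑-distrib-+ {n} (λ i → unitPart (a * from i)) (λ i → caseZero (from i) a 1#) ⟩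
    Multiplicative.∑ (λ e → unitPart (a * e)) * Multiplicative.∑ (λ e → caseZero e a 1#)
                                                       ≈⟨ *-cong (sym (Multiplicative.∑-reindex (a *_) (a⁻¹ *_) *-congˡ *-congˡ
                                                                   a[a⁻¹x]≈x a⁻¹[ax]≈x unitPart unitPart-cong))
                                                                 correction ⟩
    P * a                                              ≈⟨ *-comm P a ⟩
    a * P                                              ∎)
    where
    P = Multiplicative.∑ unitPart
    a⁻¹ = proj₁ (IsField.inverse isField a a≉0)
    aa⁻¹≈1 : a * a⁻¹ ≈ 1#
    aa⁻¹≈1 = proj₂ (IsField.inverse isField a a≉0)
    a[a⁻¹x]≈x : ∀ x → a * (a⁻¹ * x) ≈ x
    a[a⁻¹x]≈x x = trans (sym (*-assoc a a⁻¹ x)) (trans (*-congʳ aa⁻¹≈1) (*-identityˡ x))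
    a⁻¹[ax]≈x : ∀ x → a⁻¹ * (a * x) ≈ x
    a⁻¹[ax]≈x x = trans (sym (*-assoc a⁻¹ a x)) (trans (*-congʳ (trans (*-comm a⁻¹ a) aa⁻¹≈1)) (*-identityˡ x))
    -- only the factor at e = 0 differs from 1
    correction : Multiplicative.∑ (λ e → caseZero e a 1#) ≈ a
    correction = trans (Multiplicative.sum-single (to 0#) (λ i → caseZero (from i) a 1#)
                         (λ i i≢ → caseZero-nonzero a 1# (λ e≈0 → i≢ (≡.trans (≡.sym (to-from i)) (to-cong e≈0)))))
                       (caseZero-zero a 1# (from-to 0#))

module OuterBinomialTerms {c ℓ} (R : CommutativeRing c ℓ) where
  open CommutativeRing R
  open import Relation.Binary.Reasoning.Setoid setoid
  open import Algebra.Properties.Semiring.Exp semiring using (_^_)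
  open import Algebra.Properties.Semiring.Mult semiring using () renaming (_×_ to _·_)
  open import Algebra.Properties.Semiring.Sum semiring using (sum; sum-init-last; sum-cong-≋; sum-replicate-zero)
  open import Algebra.Properties.CommutativeSemiring.Binomial commutativeSemiring using (theorem; binomialTerm)

  binomial-outer : ∀ m → 1 ≤ m → (∀ k z → 1 ≤ k → k < m → (m C k) · z ≈ 0#) → ∀ x y → (x + y) ^ m ≈ x ^ m + y ^ m
  binomial-outer (suc m′) _ vanish x y = begin
    (x + y) ^ suc m′                                         ≈⟨ theorem (suc m′) x y ⟩
    term Fin.zero + sum (λ i → term (Fin.suc i))             ≈⟨ +-congˡ (sum-init-last {m′} (λ i → term (Fin.suc i))) ⟩
    term Fin.zero + (sum {m′} (λ i → term (Fin.suc (Fin.inject₁ i))) + term (Fin.suc (Fin.fromℕ m′)))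
                                                             ≈⟨ +-congˡ (+-congʳ inner≈0) ⟩
    term Fin.zero + (0# + term (Fin.suc (Fin.fromℕ m′)))     ≈⟨ +-cong first (trans (+-identityˡ _) last) ⟩
    y ^ suc m′ + x ^ suc m′                                  ≈⟨ +-comm _ _ ⟩
    x ^ suc m′ + y ^ suc m′                                  ∎
    where
    term : Fin (suc (suc m′)) → Carrier
    term = binomialTerm x y (suc m′)
    first : term Fin.zero ≈ y ^ suc m′
    first = trans (+-identityʳ _) (*-identityˡ _)
    last : term (Fin.suc (Fin.fromℕ m′)) ≈ x ^ suc m′
    last = begin
      term (Fin.suc (Fin.fromℕ m′))                          ≡⟨ ≡.cong (λ k → (suc m′ C suc k) · (x ^ suc k * y ^ (m′ ℕ.∸ k))) (FinP.toℕ-fromℕ m′) ⟩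
      (suc m′ C suc m′) · (x ^ suc m′ * y ^ (m′ ℕ.∸ m′))     ≡⟨ ≡.cong₂ (λ a b → a · (x ^ suc m′ * y ^ b)) (nCn≡1 (suc m′)) (ℕP.n∸n≡0 m′) ⟩
      1 · (x ^ suc m′ * 1#)                                  ≈⟨ +-identityʳ _ ⟩
      x ^ suc m′ * 1#                                        ≈⟨ *-identityʳ _ ⟩
      x ^ suc m′                                             ∎
    inner≈0 : sum {m′} (λ i → term (Fin.suc (Fin.inject₁ i))) ≈ 0#
    inner≈0 = trans (sum-cong-≋ {m′} (λ i → vanish (suc (Fin.toℕ (Fin.inject₁ i))) _ (s≤s z≤n)
                 (s≤s (ℕP.≤-trans (ℕP.≤-reflexive (≡.cong suc (FinP.toℕ-inject₁ i))) (FinP.toℕ<n i)))))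
              (sum-replicate-zero m′)

CharacteristicDivides : ∀ {c ℓ} → CommutativeRing c ℓ → ℕ → Set ℓ
CharacteristicDivides R m = m · 1# ≈ 0#
  where
  open CommutativeRing R
  open import Algebra.Properties.Semiring.Mult semiring using () renaming (_×_ to _·_)

-- In a commutative ring of prime characteristic p the maps x ↦ x^(p^j) are
-- additive ("freshman's dream"), since p divides the inner binomial coefficients.
module PrimeCharacteristic {c ℓ} (R : CommutativeRing c ℓ) {p : ℕ} (p-prime : Prime p)
  (char : CharacteristicDivides R p) where
  open CommutativeRing R
  open import Relation.Binary.Reasoning.Setoid setoid
  open import Algebra.Properties.Semiring.Exp semiring using (_^_; ^-congˡ; ^-assocʳ)
  open import Algebra.Properties.Semiring.Mult semiring using (×-assoc-*; ×-congʳ; ×-assocˡ) renaming (_×_ to _·_)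

  p·x≈0 : ∀ x → p · x ≈ 0#
  p·x≈0 x = begin
    p · x          ≈⟨ ×-congʳ p (*-identityˡ x) ⟨
    p · (1# * x)   ≈⟨ ×-assoc-* p 1# x ⟨
    (p · 1#) * x   ≈⟨ *-congʳ char ⟩
    0# * x         ≈⟨ zeroˡ x ⟩
    0#             ∎

  binomial-vanishes : ∀ k z → 1 ≤ k → k < p → (p C k) · z ≈ 0#
  binomial-vanishes k z 1≤k k<p with BinomialCoefficients.prime∣binomial p-prime k 1≤k k<p
  ... | divides m C≡m*p = begin
    (p C k) · z       ≡⟨ ≡.cong (_· z) (≡.trans C≡m*p (ℕP.*-comm m p)) ⟩
    (p ℕ.* m) · z     ≈⟨ ×-assocˡ z p m ⟨
    p · (m · z)       ≈⟨ p·x≈0 (m · z) ⟩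
    0#                ∎

  p≥1 : 1 ≤ p
  p≥1 = ℕP.<⇒≤ (ℕ.nonTrivial⇒n>1 p {{prime⇒nonTrivial p-prime}})

  freshman : ∀ x y → (x + y) ^ p ≈ x ^ p + y ^ p
  freshman = OuterBinomialTerms.binomial-outer R p p≥1 binomial-vanishes

  freshman-iterated : ∀ j x y → (x + y) ^ (p ℕ.^ j) ≈ x ^ (p ℕ.^ j) + y ^ (p ℕ.^ j)
  freshman-iterated zero x y = trans (*-identityʳ _) (+-cong (sym (*-identityʳ x)) (sym (*-identityʳ y)))
  freshman-iterated (suc j) x y = begin
    (x + y) ^ (p ℕ.* p ℕ.^ j)                ≈⟨ ^-assocʳ (x + y) p (p ℕ.^ j) ⟨
    ((x + y) ^ p) ^ (p ℕ.^ j)                ≈⟨ ^-congˡ (p ℕ.^ j) (freshman x y) ⟩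
    (x ^ p + y ^ p) ^ (p ℕ.^ j)              ≈⟨ freshman-iterated j (x ^ p) (y ^ p) ⟩
    (x ^ p) ^ (p ℕ.^ j) + (y ^ p) ^ (p ℕ.^ j) ≈⟨ +-cong (^-assocʳ x p (p ℕ.^ j)) (^-assocʳ y p (p ℕ.^ j)) ⟩
    x ^ (p ℕ.* p ℕ.^ j) + y ^ (p ℕ.* p ℕ.^ j) ∎

least-witness : ∀ {a} {P : ℕ → Set a} → (∀ n → Dec (P n)) → ∀ n → P n →
                Σ ℕ λ d → P d × (∀ e → e < d → ¬ P e)
least-witness P? zero P0 = 0 , P0 , λ _ ()
least-witness P? (suc n) Pn with P? 0
... | yes P0 = 0 , P0 , λ _ ()
... | no ¬P0 with least-witness (λ m → P? (suc m)) n Pn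
... | d , Pd , below = suc d , Pd , λ { zero _ → ¬P0 ; (suc e) (s≤s e<d) → below e e<d }

length-filter-split : ∀ {a b} {A : Set a} {P : A → Set b} (P? : ∀ x → Dec (P x)) xs →
                      length (filter P? xs) ℕ.+ length (filter (∁? P?) xs) ≡.≡ length xs
length-filter-split P? [] = ≡.refl
length-filter-split P? (x ∷ xs) with P? x
... | yes _ = ≡.cong suc (length-filter-split P? xs)
... | no _ = ≡.trans (ℕP.+-suc _ _) (≡.cong suc (length-filter-split P? xs))

module NormExponent {c ℓ} (R : CommutativeRing c ℓ) (q t : ℕ) (1≤q : 1 ≤ q) (t≥1 : 1 ≤ t) where
  open FF R q t using (normExp)
  open ≡ using (_≡_; cong; sym; trans)
  open ≡.≡-Reasoning

  1≤q^k : ∀ k → 1 ≤ q ℕ.^ k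
  1≤q^k k = ℕP.m^n>0 q {{ℕ.>-nonZero 1≤q}} k

  1≤normExp : ∀ k → 1 ≤ k → 1 ≤ normExp k
  1≤normExp (suc k) _ = ℕP.≤-trans (1≤q^k k) (ℕP.m≤m+n _ _)

  normExp-shift : ∀ k → q ℕ.* normExp k ℕ.+ 1 ≡ q ℕ.^ k ℕ.+ normExp k
  normExp-shift zero = cong (ℕ._+ 1) (ℕP.*-zeroʳ q)
  normExp-shift (suc k) = begin
    q ℕ.* (q ℕ.^ k ℕ.+ normExp k) ℕ.+ 1             ≡⟨ cong (ℕ._+ 1) (ℕP.*-distribˡ-+ q (q ℕ.^ k) (normExp k)) ⟩
    q ℕ.* q ℕ.^ k ℕ.+ q ℕ.* normExp k ℕ.+ 1         ≡⟨ ℕP.+-assoc (q ℕ.* q ℕ.^ k) _ 1 ⟩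
    q ℕ.* q ℕ.^ k ℕ.+ (q ℕ.* normExp k ℕ.+ 1)       ≡⟨ cong (q ℕ.* q ℕ.^ k ℕ.+_) (normExp-shift k) ⟩
    q ℕ.* q ℕ.^ k ℕ.+ (q ℕ.^ k ℕ.+ normExp k)       ∎

  s : ℕ
  s = q ℕ.∸ 1

  q≡1+s : q ≡ suc s
  q≡1+s = sym (ℕP.m+[n∸m]≡n 1≤q)

  q^t≡1+s·normExp : suc (s ℕ.* normExp t) ≡ q ℕ.^ t
  q^t≡1+s·normExp = ℕP.+-cancelˡ-≡ (normExp t) _ _ (begin
    normExp t ℕ.+ suc (s ℕ.* normExp t)  ≡⟨ ℕP.+-suc (normExp t) _ ⟩
    suc (normExp t ℕ.+ s ℕ.* normExp t)  ≡⟨ ℕP.+-comm 1 _ ⟩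
    suc s ℕ.* normExp t ℕ.+ 1            ≡⟨ cong (λ m → m ℕ.* normExp t ℕ.+ 1) q≡1+s ⟨
    q ℕ.* normExp t ℕ.+ 1                ≡⟨ normExp-shift t ⟩
    q ℕ.^ t ℕ.+ normExp t                ≡⟨ ℕP.+-comm (q ℕ.^ t) _ ⟩
    normExp t ℕ.+ q ℕ.^ t                ∎)

  j₀ : ℕ
  j₀ = normExp t ℕ.∸ 1

  1+j₀≡normExp : suc j₀ ≡ normExp t
  1+j₀≡normExp = ℕP.m+[n∸m]≡n (1≤normExp t t≥1)

  -- q^t = (q - 1)·j₀ + q, the count behind the bound |F_q| ≥ q
  q^t≡s·j₀+q : s ℕ.* j₀ ℕ.+ q ≡ q ℕ.^ t
  q^t≡s·j₀+q = begin
    s ℕ.* j₀ ℕ.+ q          ≡⟨ cong (s ℕ.* j₀ ℕ.+_) q≡1+s ⟩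
    s ℕ.* j₀ ℕ.+ suc s      ≡⟨ ℕP.+-suc (s ℕ.* j₀) s ⟩
    suc (s ℕ.* j₀ ℕ.+ s)    ≡⟨ cong suc (trans (ℕP.+-comm (s ℕ.* j₀) s) (sym (ℕP.*-suc s j₀))) ⟩
    suc (s ℕ.* suc j₀)      ≡⟨ cong (λ m → suc (s ℕ.* m)) 1+j₀≡normExp ⟩
    suc (s ℕ.* normExp t)   ≡⟨ q^t≡1+s·normExp ⟩
    q ℕ.^ t                 ∎

module FrobeniusTheory {c ℓ} (R : CommutativeRing c ℓ) (isField : IsField R) (q t : ℕ)
  (q-prime-power : PrimePower q) (card : HasCard R (q ℕ.^ t)) (t≥1 : 1 ≤ t) where
  open CommutativeRing R
  open FF R q t
  open FieldLemmas R isField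
  open FiniteField R isField card public using (_≟_; fermat)
  open DecidableFieldLemmas R isField _≟_ public
  open import Relation.Binary.Reasoning.Setoid setoid
  open import Algebra.Properties.Semiring.Exp semiring using (_^_; ^-congˡ; ^-congʳ; ^-homo-*; ^-assocʳ)
  open import Algebra.Properties.CommutativeSemiring.Exp commutativeSemiring using (^-distrib-*)
  open import Algebra.Properties.Semiring.Mult semiring using (×1-homo-*) renaming (_×_ to _·_)

  p : ℕ
  p = proj₁ q-prime-power

  e : ℕ
  e = proj₁ (proj₂ q-prime-power)

  p-prime : Prime p
  p-prime = proj₁ (proj₂ (proj₂ q-prime-power))

  1≤e : 1 ≤ e
  1≤e = proj₁ (proj₂ (proj₂ (proj₂ q-prime-power)))

  q≡p^e : q ≡.≡ p ℕ.^ e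
  q≡p^e = proj₂ (proj₂ (proj₂ (proj₂ q-prime-power)))

  q^k≡p^ek : ∀ k → q ℕ.^ k ≡.≡ p ℕ.^ (e ℕ.* k)
  q^k≡p^ek k = ≡.trans (≡.cong (ℕ._^ k) q≡p^e) (ℕP.^-*-assoc p e k)

  2≤q : 2 ≤ q
  2≤q = ℕP.≤-trans (ℕ.nonTrivial⇒n>1 p {{prime⇒nonTrivial p-prime}})
          (ℕP.≤-trans (ℕP.≤-reflexive (≡.sym (ℕP.*-identityʳ p)))
            (ℕP.≤-trans (ℕP.^-monoʳ-≤ p {{prime⇒nonZero p-prime}} 1≤e) (ℕP.≤-reflexive (≡.sym q≡p^e))))

  open NormExponent R q t (ℕP.≤-trans (s≤s z≤n) 2≤q) t≥1 public using (1≤q^k; 1≤normExp; normExp-shift)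

  -- K has characteristic p: (p·1)^(e t) = (p^(e t))·1 = |K|·1 = 0
  characteristic : CharacteristicDivides R p
  characteristic = x^k≈0⇒x≈0 (e ℕ.* t) (begin
    (p · 1#) ^ (e ℕ.* t)     ≈⟨ p^k·1≈[p·1]^k (e ℕ.* t) ⟨
    (p ℕ.^ (e ℕ.* t)) · 1#   ≡⟨ ≡.cong (_· 1#) (q^k≡p^ek t) ⟨
    (q ℕ.^ t) · 1#           ≈⟨ FiniteField.n·x≈0 R isField card 1# ⟩
    0#                       ∎)
    where
    p^k·1≈[p·1]^k : ∀ k → (p ℕ.^ k) · 1# ≈ (p · 1#) ^ k
    p^k·1≈[p·1]^k zero = +-identityʳ 1#
    p^k·1≈[p·1]^k (suc k) = trans (×1-homo-* p (p ℕ.^ k)) (*-congˡ (p^k·1≈[p·1]^k k))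

  φ : ℕ → Carrier → Carrier
  φ k x = x ^ (q ℕ.^ k)

  φ-+ : ∀ k x y → φ k (x + y) ≈ φ k x + φ k y
  φ-+ k x y = ≡.subst (λ m → (x + y) ^ m ≈ x ^ m + y ^ m) (≡.sym (q^k≡p^ek k))
                (PrimeCharacteristic.freshman-iterated R p-prime characteristic (e ℕ.* k) x y)

  φ-* : ∀ k x y → φ k (x * y) ≈ φ k x * φ k y
  φ-* k x y = ^-distrib-* x y (q ℕ.^ k)

  φ-0 : ∀ k → φ k 0# ≈ 0#
  φ-0 k = 0^k≈0 (q ℕ.^ k) (1≤q^k k)

  φ-neg : ∀ k x → φ k (- x) ≈ - φ k x
  φ-neg k x = inverseʳ-unique (φ k x) (φ k (- x)) (trans (sym (φ-+ k x (- x))) (trans (^-congˡ (q ℕ.^ k) (-‿inverseʳ x)) (φ-0 k)))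
    where open import Algebra.Properties.Group +-group using (inverseʳ-unique)

  φ-∘ : ∀ a b x → φ b (φ a x) ≈ φ (a ℕ.+ b) x
  φ-∘ a b x = trans (^-assocʳ x (q ℕ.^ a) (q ℕ.^ b)) (^-congʳ x (≡.sym (ℕP.^-distribˡ-+-* q a b)))

  φ-t : ∀ x → φ t x ≈ x
  φ-t = fermat

  -- φ_k (k ≤ t) is injective, being inverted by φ_(t-k)
  φ-injective : ∀ {x y} k → k ≤ t → φ k x ≈ φ k y → x ≈ y
  φ-injective {x} {y} k k≤t φx≈φy = begin
    x                         ≈⟨ φ-t x ⟨
    φ t x                     ≡⟨ ≡.cong (λ m → φ m x) k+[t-k]≡t ⟨
    φ (k ℕ.+ (t ℕ.∸ k)) x     ≈⟨ φ-∘ k (t ℕ.∸ k) x ⟨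
    φ (t ℕ.∸ k) (φ k x)       ≈⟨ ^-congˡ (q ℕ.^ (t ℕ.∸ k)) φx≈φy ⟩
    φ (t ℕ.∸ k) (φ k y)       ≈⟨ φ-∘ k (t ℕ.∸ k) y ⟩
    φ (k ℕ.+ (t ℕ.∸ k)) y     ≡⟨ ≡.cong (λ m → φ m y) k+[t-k]≡t ⟩
    φ t y                     ≈⟨ φ-t y ⟩
    y                         ∎
    where
    k+[t-k]≡t : k ℕ.+ (t ℕ.∸ k) ≡.≡ t
    k+[t-k]≡t = ℕP.m+[n∸m]≡n k≤t

  φ1⇒InFq : ∀ {x} → φ 1 x ≈ x → InFq x
  φ1⇒InFq {x} = trans (^-congʳ x (≡.sym (ℕP.*-identityʳ q)))

  InFq-φ : ∀ {x} → InFq x → ∀ k → φ k x ≈ x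
  InFq-φ {x} x∈Fq zero = *-identityʳ x
  InFq-φ {x} x∈Fq (suc k) = begin
    x ^ (q ℕ.* q ℕ.^ k)   ≈⟨ ^-assocʳ x q (q ℕ.^ k) ⟨
    φ k (x ^ q)           ≈⟨ ^-congˡ (q ℕ.^ k) x∈Fq ⟩
    φ k x                 ≈⟨ InFq-φ x∈Fq k ⟩
    x                     ∎

  InFq-cong : ∀ {x y} → x ≈ y → InFq x → InFq y
  InFq-cong x≈y x∈Fq = trans (^-congˡ q (sym x≈y)) (trans x∈Fq x≈y)

  InFq-1 : InFq 1#
  InFq-1 = 1^k≈1 q

  InFq-* : ∀ {x y} → InFq x → InFq y → InFq (x * y)
  InFq-* {x} {y} x∈Fq y∈Fq = trans (^-distrib-* x y q) (*-cong x∈Fq y∈Fq)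

  InFq-neg : ∀ {x} → InFq x → InFq (- x)
  InFq-neg {x} x∈Fq = φ1⇒InFq (trans (φ-neg 1 x) (-‿cong (InFq-φ x∈Fq 1)))

  N-* : ∀ x y → N (x * y) ≈ N x * N y
  N-* x y = ^-distrib-* x y (normExp t)

  N≈0⇒≈0 : ∀ {x} → N x ≈ 0# → x ≈ 0#
  N≈0⇒≈0 = x^k≈0⇒x≈0 (normExp t)

  N-cong : ∀ {x y} → x ≈ y → N x ≈ N y
  N-cong = ^-congˡ (normExp t)

  N-0 : ∀ {x} → x ≈ 0# → N x ≈ 0#
  N-0 x≈0 = trans (N-cong x≈0) (0^k≈0 (normExp t) (1≤normExp t t≥1))

  -- N(x^q)·x = x^(q^t)·N(x) = x·N(x)
  N-φ1 : ∀ x → N (x ^ q) ≈ N x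
  N-φ1 x with x ≟ 0#
  ... | yes x≈0 = trans (N-0 (trans (^-congˡ q x≈0) (0^k≈0 q (≡.subst (1 ≤_) (ℕP.*-identityʳ q) (1≤q^k 1))))) (sym (N-0 x≈0))
  ... | no x≉0 = *-cancelʳ x≉0 (begin
    N (x ^ q) * x                  ≈⟨ *-cong (^-assocʳ x q nE) (sym (*-identityʳ x)) ⟩
    x ^ (q ℕ.* nE) * x ^ 1         ≈⟨ ^-homo-* x (q ℕ.* nE) 1 ⟨
    x ^ (q ℕ.* nE ℕ.+ 1)           ≡⟨ ≡.cong (x ^_) (normExp-shift t) ⟩
    x ^ (q ℕ.^ t ℕ.+ nE)           ≈⟨ ^-homo-* x (q ℕ.^ t) nE ⟩
    φ t x * N x                    ≈⟨ *-congʳ (φ-t x) ⟩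
    x * N x                        ≈⟨ *-comm _ _ ⟩
    N x * x                        ∎)
    where nE = normExp t

  N-φ : ∀ k x → N (φ k x) ≈ N x
  N-φ zero x = N-cong (*-identityʳ x)
  N-φ (suc k) x = trans (N-cong (sym (^-assocʳ x q (q ℕ.^ k)))) (trans (N-φ k (x ^ q)) (N-φ1 x))

  InSubfield-+ : ∀ {y} a b → InSubfield a y → InSubfield b y → InSubfield (a ℕ.+ b) y
  InSubfield-+ {y} a b y∈Fa y∈Fb = trans (sym (φ-∘ a b y)) (trans (^-congˡ (q ℕ.^ b) y∈Fa) y∈Fb)

  InSubfield-* : ∀ {y} d → InSubfield d y → ∀ m → InSubfield (m ℕ.* d) y
  InSubfield-* {y} d y∈Fd zero = *-identityʳ y
  InSubfield-* {y} d y∈Fd (suc m) = InSubfield-+ d (m ℕ.* d) y∈Fd (InSubfield-* d y∈Fd m)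

  InSubfield-∸ : ∀ {y} a b → InSubfield (a ℕ.+ b) y → InSubfield a y → InSubfield b y
  InSubfield-∸ {y} a b y∈Fa+b y∈Fa = trans (sym (trans (sym (φ-∘ a b y)) (^-congˡ (q ℕ.^ b) y∈Fa))) y∈Fa+b

  φ-equal⇒InSubfield : ∀ {y} a b → b ≤ a → b ≤ t → φ a y ≈ φ b y → InSubfield (a ℕ.∸ b) y
  φ-equal⇒InSubfield {y} a b b≤a b≤t φa≈φb = φ-injective b b≤t (begin
    φ b (φ (a ℕ.∸ b) y)      ≈⟨ φ-∘ (a ℕ.∸ b) b y ⟩
    φ (a ℕ.∸ b ℕ.+ b) y      ≡⟨ ≡.cong (λ m → φ m y) (ℕP.m∸n+n≡m b≤a) ⟩
    φ a y                    ≈⟨ φa≈φb ⟩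
    φ b y                    ∎)

  InSubfield⇒φ-equal : ∀ {y} a b → b ≤ a → InSubfield (a ℕ.∸ b) y → φ a y ≈ φ b y
  InSubfield⇒φ-equal {y} a b b≤a y∈F = begin
    φ a y                    ≡⟨ ≡.cong (λ m → φ m y) (ℕP.m∸n+n≡m b≤a) ⟨
    φ (a ℕ.∸ b ℕ.+ b) y      ≈⟨ φ-∘ (a ℕ.∸ b) b y ⟨
    φ b (φ (a ℕ.∸ b) y)      ≈⟨ ^-congˡ (q ℕ.^ b) y∈F ⟩
    φ b y                    ∎

  -- the degree of y divides every k with y ∈ F_{q^k}: the remainder k mod d would be a smaller period
  degree-divides : ∀ {y} d k → DegreeIs y d → InSubfield k y → d ∣ k
  degree-divides {y} d@(suc _) k (_ , y∈Fd , minimal) y∈Fk with k % d in k%d≡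
  ... | zero = m%n≡0⇒n∣m k d k%d≡
  ... | suc r = ⊥-elim (minimal (suc r) (s≤s z≤n) (≡.subst (ℕ._< d) k%d≡ (m%n<n k d)) y∈Fr)
    where
    k≡ : k ≡.≡ (k / d) ℕ.* d ℕ.+ suc r
    k≡ = ≡.trans (m≡m%n+[m/n]*n k d) (≡.trans (≡.cong (ℕ._+ (k / d) ℕ.* d) k%d≡) (ℕP.+-comm (suc r) _))
    y∈Fr : InSubfield (suc r) y
    y∈Fr = InSubfield-∸ ((k / d) ℕ.* d) (suc r) (≡.subst (λ m → InSubfield m y) k≡ y∈Fk) (InSubfield-* d y∈Fd (k / d))

  -- every y has a degree, as y ∈ F_{q^t}
  degree-exists : ∀ y → Σ ℕ (DegreeIs y)
  degree-exists y with least-witness (λ m → φ (suc m) y ≟ y) (t ℕ.∸ 1)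
                         (≡.subst (λ m → InSubfield m y) (≡.sym (ℕP.m+[n∸m]≡n t≥1)) (φ-t y))
  ... | m , y∈Fm+1 , below = suc m , s≤s z≤n , y∈Fm+1 , minimal
    where
    minimal : ∀ e → 1 ≤ e → e < suc m → ¬ InSubfield e y
    minimal (suc e) _ (s≤s e<m) = below e e<m

  φ-equal⇒degree-divides : ∀ {y} a b d → b ≤ t → DegreeIs y d → φ a y ≈ φ b y → d ∣ (a ℕ.∸ b)
  φ-equal⇒degree-divides {y} a b d b≤t deg φa≈φb with b ℕ.≤? a
  ... | yes b≤a = degree-divides d (a ℕ.∸ b) deg (φ-equal⇒InSubfield a b b≤a b≤t φa≈φb)
  ... | no b≰a = ≡.subst (d ∣_) (≡.sym (ℕP.m≤n⇒m∸n≡0 (ℕP.<⇒≤ (ℕP.≰⇒> b≰a)))) (d ∣0)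

  degree-multiple : ∀ {y} d k → DegreeIs y d → d ∣ k → InSubfield k y
  degree-multiple {y} d k (_ , y∈Fd , _) (divides m k≡m*d) =
    ≡.subst (λ k → InSubfield k y) (≡.sym k≡m*d) (InSubfield-* d y∈Fd m)

  degree-divides⇒φ-equal : ∀ {y} a b d → DegreeIs y d → DividesDiff d a b → φ a y ≈ φ b y
  degree-divides⇒φ-equal {y} a b d deg (d∣a∸b , d∣b∸a) with b ℕ.≤? a
  ... | yes b≤a = InSubfield⇒φ-equal a b b≤a (degree-multiple d (a ℕ.∸ b) deg d∣a∸b)
  ... | no b≰a = sym (InSubfield⇒φ-equal b a (ℕP.<⇒≤ (ℕP.≰⇒> b≰a)) (degree-multiple d (b ℕ.∸ a) deg d∣b∸a))

-- Since |F_q| ≥ t, the norm determines Frobenius orbits: if N(λ + a) = N(λ + b) for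
-- all λ ∈ F_q, then b = a^(q^i) for some i < t.  Indeed, for λ ∈ F_q,
-- N(λ + x) = ∏_{i<t} (λ + x^(q^i)), so the two monic polynomials ∏ (X + a^(q^i)) and
-- ∏ (X + b^(q^i)) of degree t agree on t points and hence everywhere.
module NormOrbits {c ℓ} (R : CommutativeRing c ℓ) (isField : IsField R) (q t : ℕ)
  (q-prime-power : PrimePower q) (card : HasCard R (q ℕ.^ t)) (t≥1 : 1 ≤ t) (t≤q : t ≤ q) where
  open CommutativeRing R
  open FF R q t
  open FieldLemmas R isField
  open FrobeniusTheory R isField q t q-prime-power card t≥1
  open Polynomials R isField _≟_
  open import Relation.Binary.Reasoning.Setoid setoid
  open import Algebra.Properties.Semiring.Exp semiring using (_^_; ^-congˡ; ^-congʳ; ^-homo-*; ^-assocʳ)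
  open import Algebra.Properties.Group +-group using (∙-cancelˡ; x∙y⁻¹≈ε⇒x≈y)
  import Data.List.Relation.Unary.All as All
  import Data.List.Relation.Unary.All.Properties as AllP
  import Data.List.Relation.Unary.AllPairs.Properties as AllPairsP

  open NormExponent R q t (ℕP.≤-trans (s≤s z≤n) 2≤q) t≥1

  -- every x ∉ F_q is a root of 1 + W + … + W^(N-1) with W = X^(q-1) and N = normExp t,
  -- because w = x^(q-1) ≠ 1 satisfies w^N = x^(q^t - 1) = 1
  non-Fq-root : ∀ x → ¬ InFq x → geometric j₀ (x ^ s) ≈ 0#
  non-Fq-root x x∉Fq = geometric-root j₀ (x ^ s) w^N≈1 w≉1
    where
    x≉0 : x ≉ 0#
    x≉0 x≈0 = x∉Fq (trans (^-congˡ q x≈0) (trans (0^k≈0 q (ℕP.≤-trans (s≤s z≤n) 2≤q)) (sym x≈0)))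
    x·x^s≈x^q : x * x ^ s ≈ x ^ q
    x·x^s≈x^q = ^-congʳ x (≡.sym q≡1+s)
    w^N≈1 : (x ^ s) ^ suc j₀ ≈ 1#
    w^N≈1 = *-cancelˡ x≉0 (begin
      x * (x ^ s) ^ suc j₀        ≈⟨ *-congˡ (^-assocʳ x s (suc j₀)) ⟩
      x ^ suc (s ℕ.* suc j₀)      ≡⟨ ≡.cong (λ m → x ^ suc (s ℕ.* m)) 1+j₀≡normExp ⟩
      x ^ suc (s ℕ.* normExp t)   ≡⟨ ≡.cong (x ^_) q^t≡1+s·normExp ⟩
      φ t x                       ≈⟨ φ-t x ⟩
      x                           ≈⟨ *-identityʳ x ⟨
      x * 1#                      ∎)
    w≉1 : x ^ s ≉ 1#
    w≉1 w≈1 = x∉Fq (trans (sym x·x^s≈x^q) (trans (*-congˡ w≈1) (*-identityʳ x)))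

  -- F_q contains at least t distinct elements: at most (q - 1)(N - 1) of the q^t elements lie outside F_q
  Fq-points : Σ (List Carrier) λ xs → t ≤ length xs × AllPairs _≉_ xs × All InFq xs
  Fq-points = inside , ℕP.≤-trans t≤q q≤inside , AllPairsP.filter⁺ InFq? elements-distinct , AllP.all-filter InFq? elements
    where
    open Inverse card using (from)
    InFq? : ∀ x → Dec (InFq x)
    InFq? x = x ^ q ≟ x
    elements : List Carrier
    elements = tabulate from
    elements-distinct : AllPairs _≉_ elements
    elements-distinct = AllPairsP.tabulate⁺ (λ i≢j from-i≈from-j → i≢j (FiniteField.from-injective R isField card from-i≈from-j))
    inside = filter InFq? elements
    outside = filter (∁? InFq?) elements
    outside-bound : length outside ≤ s ℕ.* j₀
    outside-bound = root-bound (s ℕ.* j₀) (geometricLowerPart s j₀) outside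
      (length-geometricLowerPart s j₀ (ℕP.≤-pred (ℕP.≤-trans 2≤q (ℕP.≤-reflexive q≡1+s))))
      (AllPairsP.filter⁺ (∁? InFq?) elements-distinct)
      (All.map (λ {x} x∉Fq → trans (eval-geometricLowerPart s j₀ x) (non-Fq-root x x∉Fq)) (AllP.all-filter (∁? InFq?) elements))
    count : s ℕ.* j₀ ℕ.+ q ≡.≡ length inside ℕ.+ length outside
    count = ≡.trans q^t≡s·j₀+q (≡.trans (≡.sym (ListP.length-tabulate from)) (≡.sym (length-filter-split InFq? elements)))
    q≤inside : q ≤ length inside
    q≤inside = ℕP.+-cancelˡ-≤ (s ℕ.* j₀) q (length inside) (ℕP.≤-trans (ℕP.≤-reflexive count)
                 (ℕP.≤-trans (ℕP.+-monoʳ-≤ (length inside) outside-bound) (ℕP.≤-reflexive (ℕP.+-comm (length inside) _))))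

  -- for l ∈ F_q the norm factors as N(l + x) = ∏_{i<t} (l + x^(q^i)), since φ_i fixes l
  norm-as-product : ∀ {l} x → InFq l → ∀ k → (l + x) ^ normExp k ≈ linearProduct k (λ i → φ i x) l
  norm-as-product x l∈Fq zero = refl
  norm-as-product {l} x l∈Fq (suc k) = begin
    (l + x) ^ (q ℕ.^ k ℕ.+ normExp k)          ≈⟨ ^-homo-* (l + x) (q ℕ.^ k) (normExp k) ⟩
    φ k (l + x) * (l + x) ^ normExp k          ≈⟨ *-cong (trans (φ-+ k l x) (+-congʳ (InFq-φ l∈Fq k))) (norm-as-product x l∈Fq k) ⟩
    (l + φ k x) * linearProduct k (λ i → φ i x) l ∎

  conjugates : Carrier → ℕ → Carrier
  conjugates x i = φ i x

  -- if N(l + a) = N(l + b) on F_q, then ∏ (X + a^(q^i)) = ∏ (X + b^(q^i)): both are monic of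
  -- degree t, and their lower parts agree at the ≥ t points of F_q, hence everywhere
  products-agree : ∀ a b → (∀ l → InFq l → N (l + a) ≈ N (l + b)) →
                   ∀ z → linearProduct t (conjugates a) z ≈ linearProduct t (conjugates b) z
  products-agree a b norms-agree z = begin
    linearProduct t (conjugates a) z    ≈⟨ eval-lowerPart t (conjugates a) z ⟨
    z ^ t + eval la z                   ≈⟨ +-congˡ lower-parts-agree ⟩
    z ^ t + eval lb z                   ≈⟨ eval-lowerPart t (conjugates b) z ⟩
    linearProduct t (conjugates b) z    ∎
    where
    points = proj₁ Fq-points
    t≤points = proj₁ (proj₂ Fq-points)
    la = lowerPart t (conjugates a)
    lb = lowerPart t (conjugates b)
    lower-parts-agree-on-Fq : ∀ {l} → InFq l → eval la l ≈ eval lb l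
    lower-parts-agree-on-Fq {l} l∈Fq = ∙-cancelˡ (l ^ t) _ _ (begin
      l ^ t + eval la l                   ≈⟨ eval-lowerPart t (conjugates a) l ⟩
      linearProduct t (conjugates a) l    ≈⟨ norm-as-product a l∈Fq t ⟨
      N (l + a)                           ≈⟨ norms-agree l l∈Fq ⟩
      N (l + b)                           ≈⟨ norm-as-product b l∈Fq t ⟩
      linearProduct t (conjugates b) l    ≈⟨ eval-lowerPart t (conjugates b) l ⟨
      l ^ t + eval lb l                   ∎)
    lower-parts-agree : eval la z ≈ eval lb z
    lower-parts-agree = agreement points la lb
      (ℕP.≤-trans (length-lowerPart t (conjugates a)) t≤points)
      (ℕP.≤-trans (length-lowerPart t (conjugates b)) t≤points)
      (proj₁ (proj₂ (proj₂ Fq-points)))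
      (All.map lower-parts-agree-on-Fq (proj₂ (proj₂ (proj₂ Fq-points)))) z

  -- the norm determines the Frobenius orbit: -b is a root of ∏ (X + b^(q^i)) (factor i = 0),
  -- hence of ∏ (X + a^(q^i)), so -b + a^(q^i) = 0 for some i < t
  orbit-from-norm : ∀ a b → (∀ l → InFq l → N (l + a) ≈ N (l + b)) → Σ ℕ λ i → i < t × φ i a ≈ b
  orbit-from-norm a b norms-agree
    with linearProduct-root t (conjugates a) (- b) (trans (products-agree a b norms-agree (- b))
           (linearProduct-factor t (conjugates b) (- b) (trans (+-congˡ (*-identityʳ b)) (-‿inverseˡ b)) t≥1))
  ... | i , i<t , -b+φia≈0 = i , i<t , x∙y⁻¹≈ε⇒x≈y _ _ (trans (+-comm _ _) -b+φia≈0)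

module PointsOnLinesThroughP {c ℓ} (R : CommutativeRing c ℓ) (isField : IsField R) (q t : ℕ)
  (q-prime-power : PrimePower q) (card : HasCard R (q ℕ.^ t)) (t≥1 : 1 ≤ t) (t≤q : t ≤ q) where
  open CommutativeRing R
  open FF R q t
  open FieldLemmas R isField
  open FrobeniusTheory R isField q t q-prime-power card t≥1
  open NormOrbits R isField q t q-prime-power card t≥1 t≤q using (orbit-from-norm)
  open RingIdentities R using (scalar-mix)
  open import Relation.Binary.Reasoning.Setoid setoid
  open import Algebra.Properties.Semiring.Exp semiring using (_^_; ^-congˡ)
  open import Algebra.Properties.Group +-group using (x∙y⁻¹≈ε⇒x≈y; inverseʳ-unique)

  -- (i) λ(1,1) = (y, y^(q^h)) with λ ∈ F_q would put y in F_q
  P≢Q : (y : K) (h : ℕ) → ¬ InFq y → h < t → ¬ SamePoint Pv (Qv y h)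
  P≢Q y h y∉Fq _ (l , l∈Fq , _ , y≈l·1 , _) = y∉Fq (InFq-cong (sym (trans y≈l·1 (*-identityʳ l))) l∈Fq)

  -- (ii, ⇐) if Q = ⟨(a,b)⟩ is Q_{y,h}, then l(λ + μa) = w and l(λ + μb) = w^(q^h) for
  -- w = lλ + μy, so N(λ + μa) = N(λ + μb) by φ_h-invariance of N
  Q-point⇒line⊆𝒬 : ∀ a b y h → SamePoint (a , b) (Qv y h) → LineInQ Pv (a , b)
  Q-point⇒line⊆𝒬 a b y h (l , l∈Fq , l≉0 , y≈la , y^qʰ≈lb) λ′ μ λ′∈Fq μ∈Fq nonzero =
    nonzero , *-cancelˡ (λ N[l]≈0 → l≉0 (N≈0⇒≈0 N[l]≈0)) (begin
      N l * N u                ≈⟨ N-* l u ⟨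
      N (l * u)                ≈⟨ N-cong lu≈w ⟩
      N w                      ≈⟨ N-φ h w ⟨
      N (φ h w)                ≈⟨ N-cong lv≈φw ⟨
      N (l * v)                ≈⟨ N-* l v ⟩
      N l * N v                ∎)
    where
    u = λ′ * 1# + μ * a
    v = λ′ * 1# + μ * b
    l₀ = l * (λ′ * 1#)
    l₀∈Fq : InFq l₀
    l₀∈Fq = InFq-* l∈Fq (InFq-* λ′∈Fq InFq-1)
    w = l₀ + μ * y
    lu≈w : l * u ≈ w
    lu≈w = trans (scalar-mix l (λ′ * 1#) μ a) (+-congˡ (*-congˡ (sym y≈la)))
    lv≈φw : l * v ≈ φ h w
    lv≈φw = begin
      l * v                        ≈⟨ scalar-mix l (λ′ * 1#) μ b ⟩
      l₀ + μ * (l * b)             ≈⟨ +-cong (sym (InFq-φ l₀∈Fq h)) (*-cong (sym (InFq-φ μ∈Fq h)) (sym y^qʰ≈lb)) ⟩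
      φ h l₀ + φ h μ * φ h y       ≈⟨ +-congˡ (φ-* h μ y) ⟨
      φ h l₀ + φ h (μ * y)         ≈⟨ φ-+ h l₀ (μ * y) ⟨
      φ h w                        ∎

  -- (ii, ⇒) a ∈ F_q is impossible (the line would contain ⟨(0, b - a)⟩ with N(b - a) = 0, so Q = P);
  -- for a ∉ F_q the vectors (λ + a, λ + b) are nonzero, so N(λ + a) = N(λ + b) on F_q and
  -- b = a^(q^i) by orbit-from-norm
  line⊆𝒬⇒Q-point : ∀ a b → InQ (a , b) → ¬ SamePoint Pv (a , b) → LineInQ Pv (a , b) →
                     Σ K λ y → Σ ℕ λ h → ¬ InFq y × h < t × SamePoint (a , b) (Qv y h)
  line⊆𝒬⇒Q-point a b (nonzero , N[a]≈N[b]) Q≢P line with a ^ q ≟ a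
  ... | yes a∈Fq = ⊥-elim (Q≢P (a , a∈Fq , a≉0 , sym (*-identityʳ a) , trans b≈a (sym (*-identityʳ a))))
    where
    a≉0 : a ≉ 0#
    a≉0 a≈0 = [ (λ a≉0 → a≉0 a≈0) , (λ b≉0 → b≉0 (N≈0⇒≈0 (trans (sym N[a]≈N[b]) (N-0 a≈0)))) ] nonzero
    point : ∀ x → - a * 1# + 1# * x ≈ x - a
    point x = trans (+-cong (*-identityʳ _) (*-identityˡ x)) (+-comm _ _)
    b≈a : b ≈ a
    b≈a with b ≟ a
    ... | yes b≈a = b≈a
    ... | no b≉a = ⊥-elim (b≉a (x∙y⁻¹≈ε⇒x≈y b a (N≈0⇒≈0 (begin
      N (b - a)                   ≈⟨ N-cong (point b) ⟨
      N (- a * 1# + 1# * b)       ≈⟨ proj₂ (line (- a) 1# (InFq-neg a∈Fq) InFq-1 (inj₂ b-a≉0)) ⟨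
      N (- a * 1# + 1# * a)       ≈⟨ N-0 (trans (point a) (-‿inverseʳ a)) ⟩
      0#                          ∎))))
      where
      b-a≉0 : - a * 1# + 1# * b ≉ 0#
      b-a≉0 ≈0 = b≉a (x∙y⁻¹≈ε⇒x≈y b a (trans (sym (point b)) ≈0))
  ... | no a∉Fq with orbit-from-norm a b norms-agree
    where
    norms-agree : ∀ l → InFq l → N (l + a) ≈ N (l + b)
    norms-agree l l∈Fq = trans (N-cong (sym (point a))) (trans (proj₂ (line l 1# l∈Fq InFq-1 (inj₁ l+a≉0))) (N-cong (point b)))
      where
      point : ∀ x → l * 1# + 1# * x ≈ l + x
      point x = +-cong (*-identityʳ l) (*-identityˡ x)
      l+a≉0 : l * 1# + 1# * a ≉ 0#
      l+a≉0 ≈0 = a∉Fq (InFq-cong (sym (inverseʳ-unique l a (trans (sym (point a)) ≈0))) (InFq-neg l∈Fq))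
  ... | i , i<t , φia≈b = a , i , a∉Fq , i<t , 1# , InFq-1 , 1≉0 , sym (*-identityˡ a) , trans φia≈b (sym (*-identityˡ b))

  line⊆𝒬⇔Q-point : (Q : V) → InQ Q → ¬ SamePoint Pv Q →
                   (LineInQ Pv Q ⇔ Σ K λ y → Σ ℕ λ h → ¬ InFq y × h < t × SamePoint Q (Qv y h))
  line⊆𝒬⇔Q-point (a , b) Q∈𝒬 Q≢P =
    mk⇔ (line⊆𝒬⇒Q-point a b Q∈𝒬 Q≢P) (λ (y , h , _ , _ , Q≡Qyh) → Q-point⇒line⊆𝒬 a b y h Q≡Qyh)

  -- (iii) Q_{y,h} = Q_{y',h'} iff y' = λy with λ ∈ F_q and y^(q^h) = y^(q^h'), i.e. the degree of y divides h - h'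
  same-Q : (y y′ : K) (h h′ : ℕ) → ¬ InFq y → ¬ InFq y′ → h < t → h′ < t →
           (SamePoint (Qv y h) (Qv y′ h′) ⇔ (SameSpan y y′ × ((d : ℕ) → DegreeIs y d → DividesDiff d h h′)))
  same-Q y y′ h h′ _ _ h<t h′<t = mk⇔ to from
    where
    to : SamePoint (Qv y h) (Qv y′ h′) → SameSpan y y′ × ((d : ℕ) → DegreeIs y d → DividesDiff d h h′)
    to (l , l∈Fq , l≉0 , y′≈ly , φh′y′≈lφhy) =
      (l , l∈Fq , l≉0 , y′≈ly) ,
      λ d deg → φ-equal⇒degree-divides h h′ d (ℕP.<⇒≤ h′<t) deg (sym φh′y≈φhy) ,
                φ-equal⇒degree-divides h′ h d (ℕP.<⇒≤ h<t) deg φh′y≈φhy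
      where
      φh′y≈φhy : φ h′ y ≈ φ h y
      φh′y≈φhy = *-cancelˡ l≉0 (begin
        l * φ h′ y             ≈⟨ *-congʳ (InFq-φ l∈Fq h′) ⟨
        φ h′ l * φ h′ y        ≈⟨ φ-* h′ l y ⟨
        φ h′ (l * y)           ≈⟨ ^-congˡ (q ℕ.^ h′) y′≈ly ⟨
        φ h′ y′                ≈⟨ φh′y′≈lφhy ⟩
        l * φ h y              ∎)
    from : SameSpan y y′ × ((d : ℕ) → DegreeIs y d → DividesDiff d h h′) → SamePoint (Qv y h) (Qv y′ h′)
    from ((l , l∈Fq , l≉0 , y′≈ly) , divides-diff) = l , l∈Fq , l≉0 , y′≈ly , (begin
      φ h′ y′                ≈⟨ ^-congˡ (q ℕ.^ h′) y′≈ly ⟩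
      φ h′ (l * y)           ≈⟨ φ-* h′ l y ⟩
      φ h′ l * φ h′ y        ≈⟨ *-cong (InFq-φ l∈Fq h′) (sym (degree-divides⇒φ-equal h h′ d deg (divides-diff d deg))) ⟩
      l * φ h y              ∎)
      where
      d = proj₁ (degree-exists y)
      deg = proj₂ (degree-exists y)

-- Proposition 4.5.  Only t ≥ 1 (not t ≥ 3) is needed; t ≤ q provides enough points of F_q.
proposition4p5 : {c ℓ : Level} (R : CommutativeRing c ℓ) → IsField R →
    (q t : ℕ) → PrimePower q → HasCard R (q ℕ.^ t) → 3 ≤ t → t ≤ q →
    let open FF R q t in
    ((y : K) (h : ℕ) → ¬ InFq y → h < t → ¬ SamePoint Pv (Qv y h))
    ×
    ((Q : V) → InQ Q → ¬ SamePoint Pv Q →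
      (LineInQ Pv Q ⇔ Σ K λ y → Σ ℕ λ h → ¬ InFq y × h < t × SamePoint Q (Qv y h)))
    ×
    ((y y' : K) (h h' : ℕ) → ¬ InFq y → ¬ InFq y' → h < t → h' < t →
      (SamePoint (Qv y h) (Qv y' h') ⇔
        (SameSpan y y' × ((d : ℕ) → DegreeIs y d → DividesDiff d h h'))))
proposition4p5 R isField q t q-prime-power card t≥3 t≤q =
  P≢Q , line⊆𝒬⇔Q-point , same-Q
  where
  open PointsOnLinesThroughP R isField q t q-prime-power card (ℕP.≤-trans (s≤s z≤n) t≥3) t≤q
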